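{- Let $A$ be a finite alphabet and let $F$ be a uniform dill map on $A^{\mathbb N}$ with diameter $\theta$ and local rule $f$. Then for all $x,y\in A^{\mathbb N}$, $$W_H(F(x),F(y))\le \frac{\theta\,\Delta_f}{\|f\|^- }\,W_H(x,y).$$
   Context: Write $u_{[a,b)}=u_a\cdots u_{b-1}$. $d_H(u,v)=|\{i:u_i\ne v_i\}|$ for words of equal length. $W_H(x,y)=\limsup_{\ell\to\infty}\max_{k\in\mathbb N}\frac{d_H(x_{[k,k+\ell)},y_{[k,k+\ell)})}{\ell}$. A dill map with diameter $\theta\ge1$ and local rule $f:A^\theta\to A^+$ is $F(x)=f(x_{[0,\theta)})f(x_{[1,\theta+1)})\cdots$. $\|f\|^-=\min_{u\in A^\theta}|f(u)|$, $\|f\|^+=\max_{u\in A^\theta}|f(u)|$; $F$ is uniform if these are equal. For uniform $F$, $\Delta_f=\max\{d_H(f(u),f(v)):u,v\in A^\theta\}$. -}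

module Defs where

open import Data.Nat using (ℕ; zero; suc; _+_; _∸_; _<?_; _≤_)
open import Data.Fin using (Fin; toℕ; fromℕ<)
open import Data.Vec using (Vec; tabulate)
open import Data.List using (List; []; _∷_; lookup)
open import Data.List.NonEmpty using (List⁺; head; toList; length)
open import Data.Integer using (+_)
open import Data.Product using (Σ; _×_; ∃)
open import Relation.Nullary using (yes; no)
open import Relation.Binary.Definitions using (DecidableEquality)
open import Data.Rational as ℚ using (ℚ; Positive)

dH : {A : Set} → DecidableEquality A → List A → List A → ℕ
dH _≟_ [] _ = 0
dH _≟_ (_ ∷ _) [] = 0
dH _≟_ (a ∷ u) (b ∷ v) with a ≟ b
... | yes _ = dH _≟_ u v
... | no _ = suc (dH _≟_ u v)

dHseg : {A : Set} → DecidableEquality A → (ℕ → A) → (ℕ → A) → ℕ → ℕ → ℕ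
dHseg _≟_ x y k zero = 0
dHseg _≟_ x y k (suc ℓ) with x (k + ℓ) ≟ y (k + ℓ)
... | yes _ = dHseg _≟_ x y k ℓ
... | no _ = suc (dHseg _≟_ x y k ℓ)

ι : ℕ → ℚ
ι n = (+ n) ℚ./ 1

-- "W_H(x,y) ≤ r" for r ∈ ℚ:
--   limsup_{ℓ→∞} max_k d_H(x_[k,k+ℓ), y_[k,k+ℓ))/ℓ ≤ r
--   iff ∀ ε > 0 ∃ L ∀ ℓ ≥ L ∀ k, d_H(...) ≤ ℓ (r + ε).
WH≤ : {A : Set} → DecidableEquality A → (ℕ → A) → (ℕ → A) → ℚ → Set
WH≤ _≟_ x y r =
  (ε : ℚ) → Positive ε →
  ∃ λ L → (ℓ : ℕ) → L ≤ ℓ → (k : ℕ) →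
    ι (dHseg _≟_ x y k ℓ) ℚ.≤ ι ℓ ℚ.* (r ℚ.+ ε)

window : {A : Set} {θ : ℕ} → (ℕ → A) → ℕ → Vec A θ
window x i = tabulate (λ j → x (i + toℕ j))

-- n-th letter of the infinite concatenation w 0 · w 1 · w 2 ⋯ of nonempty words.
-- The fuel argument is large enough when it exceeds n (each word has length ≥ 1).
concatAt-fuel : {A : Set} → ℕ → (ℕ → List⁺ A) → ℕ → A
concatAt-fuel zero w n = head (w 0)
concatAt-fuel (suc k) w n with n <? length (w 0)
... | yes p = lookup (toList (w 0)) (fromℕ< p)
... | no _ = concatAt-fuel k (λ i → w (suc i)) (n ∸ length (w 0))

concatAt : {A : Set} → (ℕ → List⁺ A) → ℕ → A
concatAt w n = concatAt-fuel (suc n) w n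

dill : {A : Set} {θ : ℕ} → (Vec A θ → List⁺ A) → (ℕ → A) → (ℕ → A)
dill f x = concatAt (λ i → f (window x i))

-- With n the common length of the blocks f(u), the segment F(x)[K, K + ℓ) lies inside the
-- concatenation of the blocks f(x[i, i + θ)), K/n ≤ i < K/n + ℓ/n + 2.  Such a block differs
-- from f(y[i, i + θ)) in at most Δ places, and in none unless x and y differ on [i, i + θ).
-- Every input position lies in at most θ of these windows, so F(x) and F(y) differ on the
-- segment in at most θΔ times as many places as x and y do on a segment of length
-- M = ℓ/n + 2 + θ.  Since nM = ℓ + O(1), dividing by ℓ yields the factor θΔ/n in the limit.
{-# OPTIONS --safe #-}
module Submission where

open import Defs
open import Data.Nat using (ℕ; suc; _*_; _≤_)
open import Data.Fin using (Fin; _≟_)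
open import Data.Vec using (Vec)
open import Data.List.NonEmpty using (List⁺; length; toList)
open import Data.Integer using (+_)
open import Data.Product using (_×_; ∃₂)
open import Relation.Binary.PropositionalEquality using (_≡_)
open import Data.Rational as ℚ using (ℚ)

open import Data.Empty using (⊥-elim)
open import Data.Fin using (zero; suc; toℕ)
import Data.Fin.Properties as Fin
open import Data.Integer as ℤ using (-[1+_]; ∣_∣)
import Data.Integer.Properties as ℤ
open import Data.List as List using (List; []; _∷_; lookup)
open import Data.Nat using (zero; _+_; _∸_; _<_; _<?_; _⊔_; z≤n; s≤s; NonZero)
import Data.Nat.Properties as ℕ
open import Data.Nat.Solver using () renaming (module +-*-Solver to ℕ-Solver)
open import Algebra.Properties.CommutativeSemigroup ℕ.+-commutativeSemigroup using (interchange)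
open import Data.Nat.DivMod using (_/_; _%_; m/n*n≤m; m≡m%n+[m/n]*n; m%n<n)
open import Data.Product using (∃; _,_; proj₁; proj₂)
open import Data.Rational using (mkℚ; Positive; toℚᵘ)
import Data.Rational.Properties as ℚ
open import Data.Rational.Solver using () renaming (module +-*-Solver to ℚ-Solver)
open import Data.Rational.Unnormalised as ℚᵘ using (mkℚᵘ; *≤*; *≡*) renaming (_≃_ to _≃ᵘ_)
import Data.Rational.Unnormalised.Properties as ℚᵘ
open import Data.Vec.Properties using (tabulate-cong)
open import Relation.Binary.Definitions using (DecidableEquality)
open import Relation.Binary.PropositionalEquality using (refl; sym; trans; cong; cong₂; subst; subst₂; module ≡-Reasoning)
open import Relation.Nullary using (yes; no)

sumFrom : (ℕ → ℕ) → ℕ → ℕ → ℕ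
sumFrom g k zero    = 0
sumFrom g k (suc ℓ) = g k + sumFrom g (suc k) ℓ

sumFrom-++ : ∀ g k ℓ ℓ′ → sumFrom g k (ℓ + ℓ′) ≡ sumFrom g k ℓ + sumFrom g (k + ℓ) ℓ′
sumFrom-++ g k zero    ℓ′ = cong (λ i → sumFrom g i ℓ′) (sym (ℕ.+-identityʳ k))
sumFrom-++ g k (suc ℓ) ℓ′ = begin
  g k + sumFrom g (suc k) (ℓ + ℓ′)                       ≡⟨ cong (_+_ (g k)) (sumFrom-++ g (suc k) ℓ ℓ′) ⟩
  g k + (sumFrom g (suc k) ℓ + sumFrom g (suc k + ℓ) ℓ′) ≡⟨ sym (ℕ.+-assoc (g k) _ _) ⟩
  sumFrom g k (suc ℓ) + sumFrom g (suc (k + ℓ)) ℓ′       ≡⟨ cong (λ i → sumFrom g k (suc ℓ) + sumFrom g i ℓ′) (sym (ℕ.+-suc k ℓ)) ⟩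
  sumFrom g k (suc ℓ) + sumFrom g (k + suc ℓ) ℓ′         ∎
  where open ≡-Reasoning

sumFrom-snoc : ∀ g k ℓ → sumFrom g k (suc ℓ) ≡ sumFrom g k ℓ + g (k + ℓ)
sumFrom-snoc g k ℓ = begin
  sumFrom g k (suc ℓ)                  ≡⟨ cong (sumFrom g k) (ℕ.+-comm 1 ℓ) ⟩
  sumFrom g k (ℓ + 1)                  ≡⟨ sumFrom-++ g k ℓ 1 ⟩
  sumFrom g k ℓ + (g (k + ℓ) + 0)      ≡⟨ cong (_+_ (sumFrom g k ℓ)) (ℕ.+-identityʳ _) ⟩
  sumFrom g k ℓ + g (k + ℓ)            ∎
  where open ≡-Reasoning

sumFrom-zero : ∀ k ℓ → sumFrom (λ _ → 0) k ℓ ≡ 0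
sumFrom-zero k zero    = refl
sumFrom-zero k (suc ℓ) = sumFrom-zero (suc k) ℓ

sumFrom-suc : ∀ g k ℓ → sumFrom (λ i → g (suc i)) k ℓ ≡ sumFrom g (suc k) ℓ
sumFrom-suc g k zero    = refl
sumFrom-suc g k (suc ℓ) = cong (_+_ (g (suc k))) (sumFrom-suc g (suc k) ℓ)

sumFrom-+ : ∀ g h k ℓ → sumFrom (λ i → g i + h i) k ℓ ≡ sumFrom g k ℓ + sumFrom h k ℓ
sumFrom-+ g h k zero    = refl
sumFrom-+ g h k (suc ℓ) = trans (cong (_+_ (g k + h k)) (sumFrom-+ g h (suc k) ℓ))
                                (interchange (g k) (h k) _ _)

sumFrom-*ˡ : ∀ c g k ℓ → sumFrom (λ i → c * g i) k ℓ ≡ c * sumFrom g k ℓ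
sumFrom-*ˡ c g k zero    = sym (ℕ.*-zeroʳ c)
sumFrom-*ˡ c g k (suc ℓ) = trans (cong (_+_ (c * g k)) (sumFrom-*ˡ c g (suc k) ℓ))
                                 (sym (ℕ.*-distribˡ-+ c (g k) _))

sumFrom-mono-≤ : ∀ {g h} → (∀ i → g i ≤ h i) → ∀ k ℓ → sumFrom g k ℓ ≤ sumFrom h k ℓ
sumFrom-mono-≤ g≤h k zero    = z≤n
sumFrom-mono-≤ g≤h k (suc ℓ) = ℕ.+-mono-≤ (g≤h k) (sumFrom-mono-≤ g≤h (suc k) ℓ)

sumFrom-monoʳ-≤ : ∀ g k {ℓ ℓ′} → ℓ ≤ ℓ′ → sumFrom g k ℓ ≤ sumFrom g k ℓ′
sumFrom-monoʳ-≤ g k z≤n         = z≤n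
sumFrom-monoʳ-≤ g k (s≤s ℓ≤ℓ′) = ℕ.+-monoʳ-≤ (g k) (sumFrom-monoʳ-≤ g (suc k) ℓ≤ℓ′)

sumFrom-extendˡ : ∀ g k d ℓ → sumFrom g (k + d) ℓ ≤ sumFrom g k (d + ℓ)
sumFrom-extendˡ g k zero    ℓ = ℕ.≤-reflexive (cong (λ i → sumFrom g i ℓ) (ℕ.+-identityʳ k))
sumFrom-extendˡ g k (suc d) ℓ = begin
  sumFrom g (k + suc d) ℓ          ≡⟨ cong (λ i → sumFrom g i ℓ) (ℕ.+-suc k d) ⟩
  sumFrom g (suc k + d) ℓ          ≤⟨ sumFrom-extendˡ g (suc k) d ℓ ⟩
  sumFrom g (suc k) (d + ℓ)        ≤⟨ ℕ.m≤n+m _ (g k) ⟩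
  g k + sumFrom g (suc k) (d + ℓ)  ∎
  where open ℕ.≤-Reasoning

sumFrom-⊆ : ∀ g {k k′ ℓ ℓ′} → k′ ≤ k → k + ℓ ≤ k′ + ℓ′ → sumFrom g k ℓ ≤ sumFrom g k′ ℓ′
sumFrom-⊆ g {k} {k′} {ℓ} {ℓ′} k′≤k k+ℓ≤k′+ℓ′ = begin
  sumFrom g k ℓ         ≡⟨ cong (λ i → sumFrom g i ℓ) (sym k′+d≡k) ⟩
  sumFrom g (k′ + d) ℓ  ≤⟨ sumFrom-extendˡ g k′ d ℓ ⟩
  sumFrom g k′ (d + ℓ)  ≤⟨ sumFrom-monoʳ-≤ g k′ (ℕ.+-cancelˡ-≤ k′ _ _ k′+[d+ℓ]≤k′+ℓ′) ⟩
  sumFrom g k′ ℓ′       ∎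
  where
    open ℕ.≤-Reasoning
    d = k ∸ k′
    k′+d≡k : k′ + d ≡ k
    k′+d≡k = ℕ.m+[n∸m]≡n k′≤k
    k′+[d+ℓ]≤k′+ℓ′ : k′ + (d + ℓ) ≤ k′ + ℓ′
    k′+[d+ℓ]≤k′+ℓ′ = begin
      k′ + (d + ℓ)  ≡⟨ sym (ℕ.+-assoc k′ d ℓ) ⟩
      k′ + d + ℓ    ≡⟨ cong (_+ ℓ) k′+d≡k ⟩
      k + ℓ         ≤⟨ k+ℓ≤k′+ℓ′ ⟩
      k′ + ℓ′       ∎

sumFrom-blocks : ∀ g n a B → sumFrom g (a * n) (B * n) ≡ sumFrom (λ i → sumFrom g (i * n) n) a B
sumFrom-blocks g n a zero    = refl
sumFrom-blocks g n a (suc B) = begin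
  sumFrom g (a * n) (n + B * n)                          ≡⟨ sumFrom-++ g (a * n) n (B * n) ⟩
  sumFrom g (a * n) n + sumFrom g (a * n + n) (B * n)    ≡⟨ cong (λ i → sumFrom g (a * n) n + sumFrom g i (B * n)) (ℕ.+-comm (a * n) n) ⟩
  sumFrom g (a * n) n + sumFrom g (suc a * n) (B * n)    ≡⟨ cong (_+_ (sumFrom g (a * n) n)) (sumFrom-blocks g n (suc a) B) ⟩
  sumFrom (λ i → sumFrom g (i * n) n) a (suc B)          ∎
  where open ≡-Reasoning

sumFrom-windows : ∀ g θ a B → sumFrom (λ i → sumFrom g i θ) a B ≤ θ * sumFrom g a (B + θ)
sumFrom-windows g zero    a B = ℕ.≤-reflexive (sumFrom-zero a B)
sumFrom-windows g (suc θ) a B = begin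
  sumFrom (λ i → g i + sumFrom g (suc i) θ) a B            ≡⟨ sumFrom-+ g (λ i → sumFrom g (suc i) θ) a B ⟩
  sumFrom g a B + sumFrom (λ i → sumFrom g (suc i) θ) a B  ≡⟨ cong (_+_ (sumFrom g a B)) (sumFrom-suc (λ i → sumFrom g i θ) a B) ⟩
  sumFrom g a B + sumFrom (λ i → sumFrom g i θ) (suc a) B  ≤⟨ ℕ.+-monoʳ-≤ (sumFrom g a B) (sumFrom-windows g θ (suc a) B) ⟩
  sumFrom g a B + θ * sumFrom g (suc a) (B + θ)            ≤⟨ ℕ.+-mono-≤ (sumFrom-monoʳ-≤ g a (ℕ.m≤m+n B (suc θ)))
                                                                          (ℕ.*-monoʳ-≤ θ tail≤) ⟩
  sumFrom g a (B + suc θ) + θ * sumFrom g a (B + suc θ)    ∎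
  where
    open ℕ.≤-Reasoning
    tail≤ : sumFrom g (suc a) (B + θ) ≤ sumFrom g a (B + suc θ)
    tail≤ = subst (λ ℓ → sumFrom g (suc a) (B + θ) ≤ sumFrom g a ℓ) (sym (ℕ.+-suc B θ))
                  (ℕ.m≤n+m _ (g a))

sumFrom≡0⇒ : ∀ g k ℓ → sumFrom g k ℓ ≡ 0 → ∀ j → j < ℓ → g (k + j) ≡ 0
sumFrom≡0⇒ g k (suc ℓ) sum≡0 zero    _         =
  trans (cong g (ℕ.+-identityʳ k)) (ℕ.m+n≡0⇒m≡0 (g k) sum≡0)
sumFrom≡0⇒ g k (suc ℓ) sum≡0 (suc j) (s≤s j<ℓ) =
  trans (cong g (ℕ.+-suc k j)) (sumFrom≡0⇒ g (suc k) ℓ (ℕ.m+n≡0⇒n≡0 (g k) sum≡0) j j<ℓ)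

m≤n*[m/n+1+o] : ∀ m n o .{{_ : NonZero n}} → m ≤ n * (m / n + suc o)
m≤n*[m/n+1+o] m n o = begin
  m                   ≡⟨ m≡m%n+[m/n]*n m n ⟩
  m % n + m / n * n   ≤⟨ ℕ.+-monoˡ-≤ (m / n * n) (ℕ.<⇒≤ (m%n<n m n)) ⟩
  n + m / n * n       ≡⟨ cong (_+_ n) (ℕ.*-comm (m / n) n) ⟩
  n + n * (m / n)     ≡⟨ ℕ.*-suc n (m / n) ⟨
  n * suc (m / n)     ≤⟨ ℕ.*-monoʳ-≤ n (ℕ.≤-trans (s≤s (ℕ.m≤m+n (m / n) o)) (ℕ.≤-reflexive (sym (ℕ.+-suc (m / n) o)))) ⟩
  n * (m / n + suc o) ∎
  where open ℕ.≤-Reasoning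

n*[m/n+o]≤m+n*o : ∀ m n o .{{_ : NonZero n}} → n * (m / n + o) ≤ m + n * o
n*[m/n+o]≤m+n*o m n o = begin
  n * (m / n + o)      ≡⟨ ℕ.*-distribˡ-+ n (m / n) o ⟩
  n * (m / n) + n * o  ≤⟨ ℕ.+-monoˡ-≤ (n * o) (ℕ.≤-trans (ℕ.≤-reflexive (ℕ.*-comm n (m / n))) (m/n*n≤m m n)) ⟩
  m + n * o            ∎
  where open ℕ.≤-Reasoning

module _ {A : Set} (_≟_ : DecidableEquality A) where

  mismatch : A → A → ℕ
  mismatch a b with a ≟ b
  ... | yes _ = 0
  ... | no  _ = 1

  mismatches : (ℕ → A) → (ℕ → A) → ℕ → ℕ
  mismatches x y i = mismatch (x i) (y i)

  mismatch≡0⇒≡ : ∀ {a b} → mismatch a b ≡ 0 → a ≡ b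
  mismatch≡0⇒≡ {a} {b} _ with a ≟ b
  mismatch≡0⇒≡ _  | yes a≡b = a≡b
  mismatch≡0⇒≡ () | no  _

  dH-∷ : ∀ a b u v → dH _≟_ (a ∷ u) (b ∷ v) ≡ mismatch a b + dH _≟_ u v
  dH-∷ a b u v with a ≟ b
  ... | yes _ = refl
  ... | no  _ = refl

  dH-refl : ∀ u → dH _≟_ u u ≡ 0
  dH-refl []      = refl
  dH-refl (a ∷ u) with a ≟ a
  ... | yes _   = dH-refl u
  ... | no  a≢a = ⊥-elim (a≢a refl)

  dHseg-suc : ∀ x y k ℓ → dHseg _≟_ x y k (suc ℓ) ≡ dHseg _≟_ x y k ℓ + mismatches x y (k + ℓ)
  dHseg-suc x y k ℓ with x (k + ℓ) ≟ y (k + ℓ)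
  ... | yes _ = sym (ℕ.+-identityʳ _)
  ... | no  _ = ℕ.+-comm 1 _

  dHseg≡sumFrom : ∀ x y k ℓ → dHseg _≟_ x y k ℓ ≡ sumFrom (mismatches x y) k ℓ
  dHseg≡sumFrom x y k zero    = refl
  dHseg≡sumFrom x y k (suc ℓ) = begin
    dHseg _≟_ x y k (suc ℓ)                              ≡⟨ dHseg-suc x y k ℓ ⟩
    dHseg _≟_ x y k ℓ + mismatches x y (k + ℓ)            ≡⟨ cong (_+ mismatches x y (k + ℓ)) (dHseg≡sumFrom x y k ℓ) ⟩
    sumFrom (mismatches x y) k ℓ + mismatches x y (k + ℓ) ≡⟨ sumFrom-snoc (mismatches x y) k ℓ ⟨
    sumFrom (mismatches x y) k (suc ℓ)                   ∎
    where open ≡-Reasoning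

  OccursAt : List A → (ℕ → A) → ℕ → Set
  OccursAt u X c = (j : Fin (List.length u)) → X (c + toℕ j) ≡ lookup u j

  sumFrom-mismatches≡dH : ∀ {X Y c} u v → List.length u ≡ List.length v →
                          OccursAt u X c → OccursAt v Y c →
                          sumFrom (mismatches X Y) c (List.length u) ≡ dH _≟_ u v
  sumFrom-mismatches≡dH []      []      _        _    _    = refl
  sumFrom-mismatches≡dH {X} {Y} {c} (a ∷ u) (b ∷ v) |u|≡|v| occX occY = begin
    mismatch (X c) (Y c) + sumFrom (mismatches X Y) (suc c) (List.length u)
      ≡⟨ cong₂ _+_ (cong₂ mismatch (head {X} occX) (head {Y} occY))
                   (sumFrom-mismatches≡dH u v (ℕ.suc-injective |u|≡|v|) (tail {X} occX) (tail {Y} occY)) ⟩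
    mismatch a b + dH _≟_ u v
      ≡⟨ dH-∷ a b u v ⟨
    dH _≟_ (a ∷ u) (b ∷ v) ∎
    where
      open ≡-Reasoning
      head : ∀ {Z w ws} → OccursAt (w ∷ ws) Z c → Z c ≡ w
      head {Z} occ = trans (cong Z (sym (ℕ.+-identityʳ c))) (occ zero)
      tail : ∀ {Z w ws} → OccursAt (w ∷ ws) Z c → OccursAt ws Z (suc c)
      tail {Z} occ j = trans (cong Z (sym (ℕ.+-suc c (toℕ j)))) (occ (suc j))

  concatAt-fuel-lookup : ∀ {n} (w : ℕ → List⁺ A) → (∀ i → length (w i) ≡ n) →
                         ∀ {k} i (j : Fin (length (w i))) → i ≤ k →
                         concatAt-fuel (suc k) w (i * n + toℕ j) ≡ lookup (toList (w i)) j
  concatAt-fuel-lookup w len zero j _ with toℕ j <? length (w 0)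
  ... | yes j<|w₀| = cong (lookup (toList (w 0))) (Fin.fromℕ<-toℕ j j<|w₀|)
  ... | no  j≮|w₀| = ⊥-elim (j≮|w₀| (Fin.toℕ<n j))
  concatAt-fuel-lookup {n} w len {suc k} (suc i) j (s≤s i≤k) with n + i * n + toℕ j <? length (w 0)
  ... | yes p<|w₀| = ⊥-elim (ℕ.<⇒≱ p<|w₀| (begin
        length (w 0)        ≡⟨ len 0 ⟩
        n                   ≤⟨ ℕ.m≤m+n n (i * n) ⟩
        n + i * n           ≤⟨ ℕ.m≤m+n (n + i * n) (toℕ j) ⟩
        n + i * n + toℕ j   ∎))
    where open ℕ.≤-Reasoning
  ... | no  _ = trans (cong (concatAt-fuel (suc k) (λ t → w (suc t))) drop-w₀)
                      (concatAt-fuel-lookup (λ t → w (suc t)) (λ t → len (suc t)) i j i≤k)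
    where
      open ≡-Reasoning
      drop-w₀ : n + i * n + toℕ j ∸ length (w 0) ≡ i * n + toℕ j
      drop-w₀ = begin
        n + i * n + toℕ j ∸ length (w 0)  ≡⟨ cong (n + i * n + toℕ j ∸_) (len 0) ⟩
        n + i * n + toℕ j ∸ n             ≡⟨ cong (_∸ n) (ℕ.+-assoc n (i * n) (toℕ j)) ⟩
        n + (i * n + toℕ j) ∸ n           ≡⟨ ℕ.m+n∸m≡n n (i * n + toℕ j) ⟩
        i * n + toℕ j                     ∎

  window-≡ : ∀ {θ} x y i → sumFrom (mismatches x y) i θ ≡ 0 → window {θ = θ} x i ≡ window y i
  window-≡ {θ} x y i sum≡0 = tabulate-cong λ j →
    mismatch≡0⇒≡ (sumFrom≡0⇒ (mismatches x y) i θ sum≡0 (toℕ j) (Fin.toℕ<n j))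

  module _ {θ n : ℕ} .{{_ : NonZero n}} (f : Vec A θ → List⁺ A) (len : ∀ u → length (f u) ≡ n) where

    dill-occurs : ∀ x i → OccursAt (toList (f (window x i))) (dill f x) (i * n)
    dill-occurs x i j = concatAt-fuel-lookup (λ t → f (window x t)) (λ t → len (window x t)) i j
      (ℕ.≤-trans (ℕ.m≤m*n i n) (ℕ.m≤m+n (i * n) (toℕ j)))

    dill-block : ∀ x y i → sumFrom (mismatches (dill f x) (dill f y)) (i * n) n ≡
                           dH _≟_ (toList (f (window x i))) (toList (f (window y i)))
    dill-block x y i =
      subst (λ ℓ → sumFrom (mismatches (dill f x) (dill f y)) (i * n) ℓ ≡ dH _≟_ (toList (f (window x i))) (toList (f (window y i))))
            (len (window x i))
            (sumFrom-mismatches≡dH _ _ (trans (len (window x i)) (sym (len (window y i))))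
                                   (dill-occurs x i) (dill-occurs y i))

    module _ {Δ : ℕ} (dH≤Δ : ∀ u v → dH _≟_ (toList (f u)) (toList (f v)) ≤ Δ) where

      dill-block-≤ : ∀ x y i → sumFrom (mismatches (dill f x) (dill f y)) (i * n) n ≤
                                Δ * sumFrom (mismatches x y) i θ
      dill-block-≤ x y i with sumFrom (mismatches x y) i θ in sum≡
      ... | zero  = ℕ.≤-reflexive (begin
            sumFrom (mismatches (dill f x) (dill f y)) (i * n) n    ≡⟨ dill-block x y i ⟩
            dH _≟_ (toList (f (window x i))) (toList (f (window y i))) ≡⟨ cong (λ w → dH _≟_ (toList (f (window x i))) (toList (f w))) (window-≡ x y i sum≡) ⟨
            dH _≟_ (toList (f (window x i))) (toList (f (window x i))) ≡⟨ dH-refl _ ⟩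
            0                                                        ≡⟨ ℕ.*-zeroʳ Δ ⟨
            Δ * 0                                                    ∎)
        where open ≡-Reasoning
      ... | suc s = begin
            sumFrom (mismatches (dill f x) (dill f y)) (i * n) n    ≡⟨ dill-block x y i ⟩
            dH _≟_ (toList (f (window x i))) (toList (f (window y i))) ≤⟨ dH≤Δ _ _ ⟩
            Δ                                                        ≤⟨ ℕ.m≤m*n Δ (suc s) ⟩
            Δ * suc s                                                ∎
        where open ℕ.≤-Reasoning

      dHseg-dill-≤ : ∀ x y K ℓ → dHseg _≟_ (dill f x) (dill f y) K ℓ ≤
                               θ * Δ * dHseg _≟_ x y (K / n) (ℓ / n + (2 + θ))
      dHseg-dill-≤ x y K ℓ = begin
        dHseg _≟_ (dill f x) (dill f y) K ℓ             ≡⟨ dHseg≡sumFrom (dill f x) (dill f y) K ℓ ⟩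
        sumFrom D′ K ℓ                                   ≤⟨ sumFrom-⊆ D′ (m/n*n≤m K n) K+ℓ≤ ⟩
        sumFrom D′ (a * n) (B * n)                       ≡⟨ sumFrom-blocks D′ n a B ⟩
        sumFrom (λ i → sumFrom D′ (i * n) n) a B         ≤⟨ sumFrom-mono-≤ (dill-block-≤ x y) a B ⟩
        sumFrom (λ i → Δ * sumFrom D i θ) a B            ≡⟨ sumFrom-*ˡ Δ (λ i → sumFrom D i θ) a B ⟩
        Δ * sumFrom (λ i → sumFrom D i θ) a B            ≤⟨ ℕ.*-monoʳ-≤ Δ (sumFrom-windows D θ a B) ⟩
        Δ * (θ * sumFrom D a (B + θ))                    ≡⟨ ℕ.*-assoc Δ θ _ ⟨
        Δ * θ * sumFrom D a (B + θ)                      ≡⟨ cong₂ (λ c ℓ′ → c * sumFrom D a ℓ′) (ℕ.*-comm Δ θ) (ℕ.+-assoc (ℓ / n) 2 θ) ⟩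
        θ * Δ * sumFrom D a (ℓ / n + (2 + θ))            ≡⟨ cong (θ * Δ *_) (dHseg≡sumFrom x y a (ℓ / n + (2 + θ))) ⟨
        θ * Δ * dHseg _≟_ x y a (ℓ / n + (2 + θ))        ∎
        where
          open ℕ.≤-Reasoning
          D′ = mismatches (dill f x) (dill f y)
          D  = mismatches x y
          a = K / n
          b = ℓ / n
          B = b + 2
          K+ℓ≤ : K + ℓ ≤ a * n + B * n
          K+ℓ≤ = begin
            K + ℓ                               ≡⟨ cong₂ _+_ (m≡m%n+[m/n]*n K n) (m≡m%n+[m/n]*n ℓ n) ⟩
            (K % n + a * n) + (ℓ % n + b * n)   ≤⟨ ℕ.+-mono-≤ (ℕ.+-monoˡ-≤ (a * n) (ℕ.<⇒≤ (m%n<n K n)))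
                                                              (ℕ.+-monoˡ-≤ (b * n) (ℕ.<⇒≤ (m%n<n ℓ n))) ⟩
            (n + a * n) + (n + b * n)           ≡⟨ solve 3 (λ n a b → (n :+ a :* n) :+ (n :+ b :* n) := a :* n :+ (b :+ con 2) :* n)
                                                           refl n a b ⟩
            a * n + B * n                       ∎
            where open ℕ-Solver

_/1+_ : ℕ → ℕ → ℚ
a /1+ b = + a ℚ./ suc b

mkℚᵘ≃toℚᵘ-/1+ : ∀ a b → mkℚᵘ (+ a) b ≃ᵘ toℚᵘ (a /1+ b)
mkℚᵘ≃toℚᵘ-/1+ a b = ℚᵘ.≃-sym (ℚ.toℚᵘ-fromℚᵘ (mkℚᵘ (+ a) b))

/1+-mono-≤ : ∀ a b c d → a * suc d ≤ c * suc b → a /1+ b ℚ.≤ c /1+ d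
/1+-mono-≤ a b c d ad≤cb = ℚ.toℚᵘ-cancel-≤
  (ℚᵘ.≤-respˡ-≃ (mkℚᵘ≃toℚᵘ-/1+ a b) (ℚᵘ.≤-respʳ-≃ (mkℚᵘ≃toℚᵘ-/1+ c d)
    (*≤* (subst₂ ℤ._≤_ (ℤ.pos-* a (suc d)) (ℤ.pos-* c (suc b)) (ℤ.+≤+ ad≤cb)))))

/1+-cong : ∀ a b c d → a * suc d ≡ c * suc b → a /1+ b ≡ c /1+ d
/1+-cong a b c d ad≡cb = ℚ.≤-antisym (/1+-mono-≤ a b c d (ℕ.≤-reflexive ad≡cb))
                                     (/1+-mono-≤ c d a b (ℕ.≤-reflexive (sym ad≡cb)))

/1+-* : ∀ a b c d → a /1+ b ℚ.* c /1+ d ≡ (a * c) /1+ (d + b * suc d)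
/1+-* a b c d = ℚ.toℚᵘ-injective (begin
  toℚᵘ (a /1+ b ℚ.* c /1+ d)              ≈⟨ ℚ.toℚᵘ-homo-* (a /1+ b) (c /1+ d) ⟩
  toℚᵘ (a /1+ b) ℚᵘ.* toℚᵘ (c /1+ d)      ≈⟨ ℚᵘ.*-cong (mkℚᵘ≃toℚᵘ-/1+ a b) (mkℚᵘ≃toℚᵘ-/1+ c d) ⟨
  mkℚᵘ (+ a) b ℚᵘ.* mkℚᵘ (+ c) d          ≈⟨ *≡* (cong (ℤ._* + suc (d + b * suc d)) (sym (ℤ.pos-* a c))) ⟩
  mkℚᵘ (+ (a * c)) (d + b * suc d)        ≈⟨ mkℚᵘ≃toℚᵘ-/1+ (a * c) (d + b * suc d) ⟩
  toℚᵘ ((a * c) /1+ (d + b * suc d))      ∎)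
  where open ℚᵘ.≃-Reasoning

/1+-*-ι : ∀ a b → a /1+ b ℚ.* ι (suc b) ≡ ι a
/1+-*-ι a b = trans (/1+-* a b (suc b) 0)
  (/1+-cong (a * suc b) (0 + b * 1) a 0 (trans (ℕ.*-identityʳ (a * suc b)) (cong (λ e → a * suc e) (sym (ℕ.*-identityʳ b)))))

/1+-*-1/1+≤1 : ∀ a b → a /1+ b ℚ.* (1 /1+ a) ℚ.≤ ℚ.1ℚ
/1+-*-1/1+≤1 a b = subst (ℚ._≤ ℚ.1ℚ) (sym (/1+-* a b 1 a))
  (/1+-mono-≤ (a * 1) (a + b * suc a) 1 0
    (ℕ.≤-trans (ℕ.≤-reflexive (trans (ℕ.*-identityʳ (a * 1)) (ℕ.*-identityʳ a)))
               (ℕ.≤-trans (ℕ.m≤m+n a (b * suc a)) (ℕ.≤-trans (ℕ.n≤1+n _) (ℕ.m≤m+n _ 0)))))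

ι-mono-≤ : ∀ {m n} → m ≤ n → ι m ℚ.≤ ι n
ι-mono-≤ {m} {n} m≤n = /1+-mono-≤ m 0 n 0 (ℕ.*-monoˡ-≤ 1 m≤n)

ι-* : ∀ m n → ι (m * n) ≡ ι m ℚ.* ι n
ι-* m n = sym (/1+-* m 0 n 0)

ι-+ : ∀ m n → ι (m + n) ≡ ι m ℚ.+ ι n
ι-+ m n = ℚ.toℚᵘ-injective (begin
  toℚᵘ (ι (m + n))                   ≈⟨ mkℚᵘ≃toℚᵘ-/1+ (m + n) 0 ⟨
  mkℚᵘ (+ (m + n)) 0                 ≈⟨ *≡* (cong (ℤ._* + 1) +[m+n]≡) ⟩
  mkℚᵘ (+ m) 0 ℚᵘ.+ mkℚᵘ (+ n) 0     ≈⟨ ℚᵘ.+-cong (mkℚᵘ≃toℚᵘ-/1+ m 0) (mkℚᵘ≃toℚᵘ-/1+ n 0) ⟩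
  toℚᵘ (ι m) ℚᵘ.+ toℚᵘ (ι n)         ≈⟨ ℚ.toℚᵘ-homo-+ (ι m) (ι n) ⟨
  toℚᵘ (ι m ℚ.+ ι n)                 ∎)
  where
    open ℚᵘ.≃-Reasoning
    +[m+n]≡ : + (m + n) ≡ + m ℤ.* + 1 ℤ.+ + n ℤ.* + 1
    +[m+n]≡ = trans (ℤ.pos-+ m n) (sym (cong₂ ℤ._+_ (ℤ.*-identityʳ (+ m)) (ℤ.*-identityʳ (+ n))))

p≤ι∣↥p∣ : ∀ p → p ℚ.≤ ι ∣ ℚ.↥ p ∣
p≤ι∣↥p∣ (mkℚ t d _) = ℚ.toℚᵘ-cancel-≤ (ℚᵘ.≤-respʳ-≃ (mkℚᵘ≃toℚᵘ-/1+ ∣ t ∣ 0) (*≤* (t≤∣t∣*[1+d] t)))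
  where
    t≤∣t∣*[1+d] : ∀ i → i ℤ.* + 1 ℤ.≤ + ∣ i ∣ ℤ.* + suc d
    t≤∣t∣*[1+d] (+ k)    = subst₂ ℤ._≤_ (ℤ.pos-* k 1) (ℤ.pos-* k (suc d)) (ℤ.+≤+ (ℕ.*-monoʳ-≤ k (s≤s z≤n)))
    t≤∣t∣*[1+d] -[1+ k ] = ℤ.-≤+

archimedean : ∀ t ε → Positive ε → ∃ λ N → t ℚ.≤ ι N ℚ.* ε
archimedean t ε@(mkℚ (+ suc p) d _) _ = T * suc d , ℚ.≤-trans (p≤ι∣↥p∣ t) (begin
  ι T                                ≤⟨ /1+-mono-≤ T 0 (T * suc d * suc p) (d + 0) T*[1+d]≤ ⟩
  (T * suc d * suc p) /1+ (d + 0)    ≡⟨ /1+-* (T * suc d) 0 (suc p) d ⟨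
  ι (T * suc d) ℚ.* (suc p /1+ d)    ≡⟨ cong (ι (T * suc d) ℚ.*_) (ℚ.↥p/↧p≡p ε) ⟩
  ι (T * suc d) ℚ.* ε                ∎)
  where
    open ℚ.≤-Reasoning
    T = ∣ ℚ.↥ t ∣
    T*[1+d]≤ : T * suc (d + 0) ≤ T * suc d * suc p * 1
    T*[1+d]≤ = subst (λ e → T * suc e ≤ T * suc d * suc p * 1) (sym (ℕ.+-identityʳ d))
                     (ℕ.≤-trans (ℕ.m≤m*n (T * suc d) (suc p)) (ℕ.≤-reflexive (sym (ℕ.*-identityʳ _))))

ι≤ι[1+n]*p⇒0≤p : ∀ m n p → ι m ℚ.≤ ι (suc n) ℚ.* p → ℚ.0ℚ ℚ.≤ p
ι≤ι[1+n]*p⇒0≤p m n p ι≤ = ℚ.*-cancelˡ-≤-pos (ι (suc n)) {{ℚ.normalize-pos (suc n) 1}} (begin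
  ι (suc n) ℚ.* ℚ.0ℚ   ≡⟨ ℚ.*-zeroʳ (ι (suc n)) ⟩
  ℚ.0ℚ                 ≤⟨ ι-mono-≤ {n = m} z≤n ⟩
  ι m                  ≤⟨ ι≤ ⟩
  ι (suc n) ℚ.* p      ∎)
  where open ℚ.≤-Reasoning

-- WH≤ _≟_ x y r unfolds to Rate≤ (dHseg _≟_ x y) r.
Rate≤ : (ℕ → ℕ → ℕ) → ℚ → Set
Rate≤ d r = (ε : ℚ) → Positive ε →
            ∃ λ L → (ℓ : ℕ) → L ≤ ℓ → (k : ℕ) → ι (d k ℓ) ℚ.≤ ι ℓ ℚ.* (r ℚ.+ ε)

Rate≤-absorb : ∀ {d r} →
  ((ε : ℚ) → Positive ε →
     ∃₂ λ c L → (ℓ : ℕ) → L ≤ ℓ → (k : ℕ) → ι (d k ℓ) ℚ.≤ ι ℓ ℚ.* (r ℚ.+ ε) ℚ.+ c) →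
  Rate≤ d r
Rate≤-absorb {d} {r} bounded ε ε>0 = L ⊔ N , λ ℓ L⊔N≤ℓ k → begin
  ι (d k ℓ)                          ≤⟨ d≤ ℓ (ℕ.m⊔n≤o⇒m≤o L N L⊔N≤ℓ) k ⟩
  ι ℓ ℚ.* (r ℚ.+ δ) ℚ.+ c            ≤⟨ ℚ.+-monoʳ-≤ (ι ℓ ℚ.* (r ℚ.+ δ))
                                          (ℚ.≤-trans c≤Nδ (ℚ.*-monoʳ-≤-nonNeg δ {{ℚ.pos⇒nonNeg δ {{δ>0}}}}
                                                                                (ι-mono-≤ (ℕ.m⊔n≤o⇒n≤o L N L⊔N≤ℓ)))) ⟩
  ι ℓ ℚ.* (r ℚ.+ δ) ℚ.+ ι ℓ ℚ.* δ    ≡⟨ solve 3 (λ l r δ → l :* (r :+ δ) :+ l :* δ := l :* (r :+ (δ :+ δ))) refl (ι ℓ) r δ ⟩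
  ι ℓ ℚ.* (r ℚ.+ (δ ℚ.+ δ))          ≡⟨ cong (λ e → ι ℓ ℚ.* (r ℚ.+ e)) δ+δ≡ε ⟩
  ι ℓ ℚ.* (r ℚ.+ ε)                  ∎
  where
    open ℚ.≤-Reasoning
    open ℚ-Solver
    δ = ε ℚ.* (1 /1+ 1)
    δ>0 : Positive δ
    δ>0 = ℚ.pos*pos⇒pos ε {{ε>0}} (1 /1+ 1)
    δ+δ≡ε : δ ℚ.+ δ ≡ ε
    δ+δ≡ε = trans (sym (ℚ.*-distribˡ-+ ε (1 /1+ 1) (1 /1+ 1))) (ℚ.*-identityʳ ε)
    c = proj₁ (bounded δ δ>0)
    L = proj₁ (proj₂ (bounded δ δ>0))
    d≤ = proj₂ (proj₂ (bounded δ δ>0))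
    N = proj₁ (archimedean c δ δ>0)
    c≤Nδ = proj₂ (archimedean c δ δ>0)

ι-≤-rescale : ∀ C m {y x M N} s → ℚ.0ℚ ℚ.≤ s → y ≤ C * x → ι x ℚ.≤ ι M ℚ.* s → suc m * M ≤ N →
              ι y ℚ.≤ C /1+ m ℚ.* ι N ℚ.* s
ι-≤-rescale C m {y} {x} {M} {N} s 0≤s y≤Cx x≤Ms nM≤N = begin
  ι y                          ≤⟨ ι-mono-≤ y≤Cx ⟩
  ι (C * x)                    ≡⟨ ι-* C x ⟩
  ι C ℚ.* ι x                  ≤⟨ ℚ.*-monoˡ-≤-nonNeg (ι C) {{ℚ.normalize-nonNeg C 1}} x≤Ms ⟩
  ι C ℚ.* (ι M ℚ.* s)          ≡⟨ cong (ℚ._* (ι M ℚ.* s)) (/1+-*-ι C m) ⟨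
  q ℚ.* ι n ℚ.* (ι M ℚ.* s)    ≡⟨ solve 4 (λ q n M s → q :* n :* (M :* s) := q :* (n :* M) :* s) refl q (ι n) (ι M) s ⟩
  q ℚ.* (ι n ℚ.* ι M) ℚ.* s    ≡⟨ cong (λ t → q ℚ.* t ℚ.* s) (ι-* n M) ⟨
  q ℚ.* ι (n * M) ℚ.* s        ≤⟨ ℚ.*-monoʳ-≤-nonNeg s {{ℚ.nonNegative 0≤s}}
                                    (ℚ.*-monoˡ-≤-nonNeg q {{ℚ.normalize-nonNeg C n}} (ι-mono-≤ nM≤N)) ⟩
  q ℚ.* ι N ℚ.* s              ∎
  where
    open ℚ.≤-Reasoning
    open ℚ-Solver
    q = C /1+ m
    n = suc m

Rate≤-transfer : ∀ dF dx {r} (C m E : ℕ) → Rate≤ dx r →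
  (∀ K ℓ → ∃₂ λ a M → dF K ℓ ≤ C * dx a M × ℓ ≤ suc m * M × suc m * M ≤ ℓ + E) →
  Rate≤ dF (C /1+ m ℚ.* r)
Rate≤-transfer dF dx {r} C m E dx≤r cover = Rate≤-absorb {dF} {q ℚ.* r} bounded
  where
    q = C /1+ m
    n = suc m
    bounded : (ε : ℚ) → Positive ε →
      ∃₂ λ c L → (ℓ : ℕ) → L ≤ ℓ → (k : ℕ) → ι (dF k ℓ) ℚ.≤ ι ℓ ℚ.* (q ℚ.* r ℚ.+ ε) ℚ.+ c
    bounded ε ε>0 = q ℚ.* ι E ℚ.* s , n * L , dF≤
      where
        open ℚ.≤-Reasoning
        open ℚ-Solver
        ε′ = ε ℚ.* (1 /1+ C)
        ε′>0 : Positive ε′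
        ε′>0 = ℚ.pos*pos⇒pos ε {{ε>0}} (1 /1+ C) {{ℚ.normalize-pos 1 (suc C)}}
        L = proj₁ (dx≤r ε′ ε′>0)
        dx≤ = proj₂ (dx≤r ε′ ε′>0)
        s = r ℚ.+ ε′
        0≤s : ℚ.0ℚ ℚ.≤ s
        0≤s = ι≤ι[1+n]*p⇒0≤p (dx 0 (suc L)) L s (dx≤ (suc L) (ℕ.n≤1+n L) 0)
        qε′≤ε : q ℚ.* ε′ ℚ.≤ ε
        qε′≤ε = begin
          q ℚ.* (ε ℚ.* (1 /1+ C))   ≡⟨ solve 3 (λ q ε w → q :* (ε :* w) := ε :* (q :* w)) refl q ε (1 /1+ C) ⟩
          ε ℚ.* (q ℚ.* (1 /1+ C))   ≤⟨ ℚ.*-monoˡ-≤-nonNeg ε {{ℚ.pos⇒nonNeg ε {{ε>0}}}} (/1+-*-1/1+≤1 C m) ⟩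
          ε ℚ.* ℚ.1ℚ                ≡⟨ ℚ.*-identityʳ ε ⟩
          ε                         ∎
        dF≤ : (ℓ : ℕ) → n * L ≤ ℓ → (K : ℕ) →
              ι (dF K ℓ) ℚ.≤ ι ℓ ℚ.* (q ℚ.* r ℚ.+ ε) ℚ.+ q ℚ.* ι E ℚ.* s
        dF≤ ℓ nL≤ℓ K with cover K ℓ
        ... | a , M , dF≤Cdx , ℓ≤nM , nM≤ℓ+E = begin
          ι (dF K ℓ)                                          ≤⟨ ι-≤-rescale C m s 0≤s dF≤Cdx (dx≤ M L≤M a) nM≤ℓ+E ⟩
          q ℚ.* ι (ℓ + E) ℚ.* s                               ≡⟨ cong (λ t → q ℚ.* t ℚ.* s) (ι-+ ℓ E) ⟩
          q ℚ.* (ι ℓ ℚ.+ ι E) ℚ.* (r ℚ.+ ε′)                  ≡⟨ solve 5 (λ q l e r ε′ → q :* (l :+ e) :* (r :+ ε′) := l :* (q :* r :+ q :* ε′) :+ q :* e :* (r :+ ε′))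
                                                                      refl q (ι ℓ) (ι E) r ε′ ⟩
          ι ℓ ℚ.* (q ℚ.* r ℚ.+ q ℚ.* ε′) ℚ.+ q ℚ.* ι E ℚ.* s  ≤⟨ ℚ.+-monoˡ-≤ (q ℚ.* ι E ℚ.* s)
                                                                   (ℚ.*-monoˡ-≤-nonNeg (ι ℓ) {{ℚ.normalize-nonNeg ℓ 1}} (ℚ.+-monoʳ-≤ (q ℚ.* r) qε′≤ε)) ⟩
          ι ℓ ℚ.* (q ℚ.* r ℚ.+ ε) ℚ.+ q ℚ.* ι E ℚ.* s         ∎
          where
            L≤M : L ≤ M
            L≤M = ℕ.*-cancelˡ-≤ n (ℕ.≤-trans nL≤ℓ ℓ≤nM)

proposition1 : (a θ : ℕ) → 1 ≤ θ → (f : Vec (Fin a) θ → List⁺ (Fin a)) →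
    (m : ℕ) → ((u : Vec (Fin a) θ) → length (f u) ≡ suc m) →
    (Δ : ℕ) → ((u v : Vec (Fin a) θ) → dH _≟_ (toList (f u)) (toList (f v)) ≤ Δ) →
    ∃₂ (λ u v → dH _≟_ (toList (f u)) (toList (f v)) ≡ Δ) →
    (x y : ℕ → Fin a) → (r : ℚ) →
    WH≤ _≟_ x y r →
    WH≤ _≟_ (dill f x) (dill f y) (((+ (θ * Δ)) ℚ./ suc m) ℚ.* r)
proposition1 a θ _ f m len Δ dH≤Δ _ x y r x~y =
  Rate≤-transfer (dHseg _≟_ (dill f x) (dill f y)) (dHseg _≟_ x y) (θ * Δ) m (n * (2 + θ)) x~y λ K ℓ →
    K / n
  , ℓ / n + (2 + θ)
  , dHseg-dill-≤ _≟_ f len dH≤Δ x y K ℓ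
  , m≤n*[m/n+1+o] ℓ n (suc θ)
  , n*[m/n+o]≤m+n*o ℓ n (2 + θ)
  where n = suc m
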